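{- Let $\mathcal{H}$ be a 3-uniform hypergraph containing no copy of $\mathcal{L}$, and let $\mathcal{H}'$ be the 22-core of $\mathcal{H}$. Then there is a partition of $V(\mathcal{H}')$ into three sets $X, Y, Z$, a partition of $X$ into sets of size 2, and a partition of $Z$ into sets $(A_v : v \in Y)$, such that every triple $e \in \mathcal{H}'$ is of one of the following two forms: (i) $e \cap X$ is one of the pairs in the partition of $X$ and $|e \cap Y| = 1$; (ii) $e \cap Y = \{y\}$ for some $y \in Y$ and $e \setminus \{y\} \subseteq A_y$.
   Context: The loose path $\mathcal{L}$ is the 3-uniform hypergraph $\{abc, cde, efg\}$ on seven distinct vertices. The degree of a vertex in a 3-uniform hypergraph is the number of triples containing it. The $m$-core of a hypergraph is the subhypergraph obtained by iteratively deleting vertices of degree less than $m$ (together with all triples containing them) until every remaining vertex has degree at least $m$ (or the hypergraph is empty); $V(\mathcal{H}')$ denotes its remaining vertex set. -}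

module Defs where

open import Data.Nat using (ℕ; _≤_; _<_)
open import Data.Fin using (Fin)
open import Data.Fin.Subset using (Subset; ⁅_⁆; _∈_; _⊆_; _∩_; _∪_; _-_; ∣_∣; Empty; ⊤)
open import Data.Fin.Subset.Properties using (_∈?_; _⊆?_)
open import Data.List using (List; filter; length)
open import Data.List.Relation.Unary.All using (All)
open import Data.List.Relation.Unary.Unique.Propositional using (Unique)
import Data.List.Membership.Propositional as LM
open import Data.Product using (Σ; ∃; _×_; _,_)
open import Data.Sum using (_⊎_)
open import Relation.Nullary using (¬_)
open import Relation.Binary.PropositionalEquality using (_≡_; _≢_)
open import Relation.Binary.Construct.Closure.ReflexiveTransitive using (Star)

record Hypergraph3 (n : ℕ) : Set where
  field
    edges   : List (Subset n)
    unique  : Unique edges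
    uniform : All (λ e → ∣ e ∣ ≡ 3) edges
open Hypergraph3 public

triple : ∀ {n} → Fin n → Fin n → Fin n → Subset n
triple a b c = (⁅ a ⁆ ∪ ⁅ b ⁆) ∪ ⁅ c ⁆

-- H contains a copy of the loose path L = {abc, cde, efg} on 7 distinct vertices.
ContainsLoosePath : ∀ {n} → Hypergraph3 n → Set
ContainsLoosePath {n} H =
  Σ (Fin n) λ a → Σ (Fin n) λ b → Σ (Fin n) λ c → Σ (Fin n) λ d →
  Σ (Fin n) λ e → Σ (Fin n) λ f → Σ (Fin n) λ g →
    (a ≢ b × a ≢ c × a ≢ d × a ≢ e × a ≢ f × a ≢ g ×
     b ≢ c × b ≢ d × b ≢ e × b ≢ f × b ≢ g ×
     c ≢ d × c ≢ e × c ≢ f × c ≢ g ×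
     d ≢ e × d ≢ f × d ≢ g ×
     e ≢ f × e ≢ g ×
     f ≢ g) ×
    (triple a b c LM.∈ edges H) × (triple c d e LM.∈ edges H) × (triple e f g LM.∈ edges H)

edgesOn : ∀ {n} → Hypergraph3 n → Subset n → List (Subset n)
edgesOn H S = filter (_⊆? S) (edges H)

degreeOn : ∀ {n} → Hypergraph3 n → Subset n → Fin n → ℕ
degreeOn H S v = length (filter (v ∈?_) (edgesOn H S))

data CoreStep {n} (H : Hypergraph3 n) (m : ℕ) : Subset n → Subset n → Set where
  delete : ∀ {S} v → v ∈ S → degreeOn H S v < m → CoreStep H m S (S - v)

IsCoreVertexSet : ∀ {n} → Hypergraph3 n → ℕ → Subset n → Set
IsCoreVertexSet H m S =
  Star (CoreStep H m) ⊤ S × (∀ v → v ∈ S → m ≤ degreeOn H S v)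

Disjoint : ∀ {n} → Subset n → Subset n → Set
Disjoint p q = Empty (p ∩ q)

Partition3 : ∀ {n} → Subset n → Subset n → Subset n → Subset n → Set
Partition3 U X Y Z =
  (X ∪ Y) ∪ Z ≡ U × Disjoint X Y × Disjoint X Z × Disjoint Y Z

PairPartition : ∀ {n k} → Subset n → (Fin k → Subset n) → Set
PairPartition {n} {k} X P =
  (∀ i → ∣ P i ∣ ≡ 2) × (∀ i → P i ⊆ X) ×
  (∀ x → x ∈ X → ∃ λ i → x ∈ P i) ×
  (∀ i j → i ≢ j → Disjoint (P i) (P j))

-- The family (A v : v ∈ Y) is a partition of Z (parts may be empty).
IndexedPartition : ∀ {n} → Subset n → Subset n → (Fin n → Subset n) → Set
IndexedPartition {n} Y Z A =
  (∀ v → v ∈ Y → A v ⊆ Z) ×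
  (∀ z → z ∈ Z → ∃ λ v → v ∈ Y × z ∈ A v) ×
  (∀ v w → v ∈ Y → w ∈ Y → v ≢ w → Disjoint (A v) (A w))

Structured : ∀ {n} → List (Subset n) → Subset n → Set
Structured {n} E S =
  Σ (Subset n) λ X → Σ (Subset n) λ Y → Σ (Subset n) λ Z →
  Σ ℕ λ k → Σ (Fin k → Subset n) λ P → Σ (Fin n → Subset n) λ A →
    Partition3 S X Y Z × PairPartition X P × IndexedPartition Y Z A ×
    (∀ e → e LM.∈ E →
       ((∃ λ i → e ∩ X ≡ P i) × ∣ e ∩ Y ∣ ≡ 1)
       ⊎ (∃ λ y → y ∈ Y × e ∩ Y ≡ ⁅ y ⁆ × (e - y) ⊆ A y))

module Submission where

-- Work inside the core: a vertex set S and its edge list E, in which every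
-- vertex of S has degree at least 21 (the argument never needs 22).  Call c a
-- partner of u if c ≠ u and every edge through u contains c.  Counting shows
-- that a vertex of S has at most one partner and that partnership is
-- symmetric whenever both ends have partners.  The two substantial lemmas are
--   * a transversal lemma: if at most four vertices meet every edge through u,
--     then u has a partner (a pigeonhole argument produces a vertex sharing six
--     edges with u; if it were no partner, some vertex would have degree ≤ 7
--     or a loose path would appear), and
--   * every neighbour of a partnerless vertex has a partner.
-- Consequently every edge has exactly one partnerless vertex y.  With Y the
-- partnerless vertices, X those whose partner has a partner (these pair up),
-- Z the rest and A_y the vertices whose partner is y, an edge is either a pair
-- of X plus y, or y plus two vertices of A_y.

open import Data.Bool using (Bool; true; false)
import Data.Bool.Properties as Bool
open import Data.Empty using (⊥; ⊥-elim)
open import Data.Fin using (Fin; zero; suc; toℕ)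
import Data.Fin.Properties as Fin
open import Data.Fin.Subset
  using (Subset; ⁅_⁆; _∈_; _∉_; _⊆_; _∩_; _∪_; _─_; _-_; ∣_∣; inside; outside)
open import Data.Fin.Subset.Properties
  using (_∈?_; _⊆?_; ⊆-antisym; x∈p∪q⁺; x∈p∪q⁻; x∈p∩q⁺; x∈p∩q⁻; x∈⁅x⁆; x∈⁅y⁆⇒x≡y;
         x∉⁅y⁆⇒x≢y; ∣⁅x⁆∣≡1; p─q⊆p)
open import Data.List using (List; []; _∷_; _++_; filter; length; map; concatMap; lookup; allFin)
open import Data.List.Properties using (filter-all; length-++; length-map)
open import Data.List.Membership.Propositional using (find; lose) renaming (_∈_ to _∈L_; _∉_ to _∉L_)
open import Data.List.Membership.Propositional.Properties
  using (∈-filter⁺; ∈-filter⁻; ∈-map⁺; ∈-map⁻; ∈-++⁺ˡ; ∈-++⁺ʳ; ∈-concatMap⁺; ∈-allFin; ∈-lookup)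
import Data.List.Membership.DecPropositional as DecMembership
open import Data.List.Relation.Unary.Any as Any using (Any; here; there; any?)
open import Data.List.Relation.Unary.Any.Properties using (lookup-index)
open import Data.List.Relation.Unary.All as All using (All; []; _∷_; all?)
open import Data.List.Relation.Unary.All.Properties using (¬All⇒Any¬)
open import Data.List.Relation.Unary.AllPairs using ([]; _∷_)
open import Data.List.Relation.Unary.Unique.Propositional using (Unique)
import Data.List.Relation.Unary.Unique.Propositional.Properties as Unique
open import Data.Nat using (ℕ; suc; _+_; _*_; _≤_; _<_; z≤n; s≤s; _<?_)
open import Data.Nat.Properties
  using (≤-refl; ≤-reflexive; ≤-trans; ≤-antisym; ≤-pred; <⇒≱; ≰⇒>; ≮⇒≥; ≤∧≢⇒<; <-asym;
         1+n≰n; n≤1+n; +-mono-≤; +-monoˡ-≤; *-monoˡ-≤; m≤m+n; suc-injective; 0≢1+n;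
         module ≤-Reasoning)
open import Data.Product using (Σ; ∃; _×_; _,_; proj₁; proj₂)
open import Data.Sum using (_⊎_; inj₁; inj₂; map₂; swap)
open import Data.Vec using ([]; _∷_; here; there; tabulate)
import Data.Vec.Properties as Vec
open import Function using (_∘_)
open import Function.Bundles using (Inverse)
open import Relation.Binary.Definitions using (DecidableEquality)
open import Relation.Binary.PropositionalEquality
  using (_≡_; _≢_; refl; sym; trans; cong; subst; subst₂; ≢-sym; module ≡-Reasoning)
open import Relation.Nullary using (¬_; Dec; yes; no; ¬?; does)
open import Relation.Nullary.Decidable using (dec-true; decidable-stable; map′; _×-dec_; _→-dec_)
open import Relation.Unary using (Decidable)

open import Defs

all-or-counterexample : ∀ {a p} {A : Set a} {P : A → Set p} → Decidable P →
  (xs : List A) → All P xs ⊎ ∃ λ x → x ∈L xs × ¬ P x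
all-or-counterexample P? xs with all? P? xs
... | yes allP = inj₁ allP
... | no ¬allP = inj₂ (find (¬All⇒Any¬ P? xs ¬allP))

∉L∧∈L⇒≢ : ∀ {a} {A : Set a} {xs : List A} {x y : A} → x ∉L xs → y ∈L xs → x ≢ y
∉L∧∈L⇒≢ x∉ y∈ refl = x∉ y∈

lookup-injective : ∀ {a} {A : Set a} {xs : List A} → Unique xs →
  ∀ i j → lookup xs i ≡ lookup xs j → i ≡ j
lookup-injective {xs = _ ∷ _}  _          zero    zero    _  = refl
lookup-injective {xs = _ ∷ xs} (x∉ ∷ _)   zero    (suc j) eq =
  ⊥-elim (All.lookup x∉ (∈-lookup {xs = xs} j) eq)
lookup-injective {xs = _ ∷ xs} (x∉ ∷ _)   (suc i) zero    eq =
  ⊥-elim (All.lookup x∉ (∈-lookup {xs = xs} i) (sym eq))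
lookup-injective {xs = _ ∷ _}  (_ ∷ xs!) (suc i) (suc j) eq = cong suc (lookup-injective xs! i j eq)

length-concatMap≤ : ∀ {a b} {A : Set a} {B : Set b} (f : A → List B) (k : ℕ) (ts : List A) →
  All (λ t → length (f t) ≤ k) ts → length (concatMap f ts) ≤ length ts * k
length-concatMap≤ f k []       []             = z≤n
length-concatMap≤ f k (t ∷ ts) (short ∷ rest) = begin
  length (f t ++ concatMap f ts)        ≡⟨ length-++ (f t) ⟩
  length (f t) + length (concatMap f ts) ≤⟨ +-mono-≤ short (length-concatMap≤ f k ts rest) ⟩
  k + length ts * k                      ∎
  where open ≤-Reasoning

record LargeEntry {a} {A : Set a} (f : A → ℕ) (k : ℕ) (ts : List A) : Set a where
  field
    large   : A
    others  : List A
    large∈  : large ∈L ts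
    others⊆ : ∀ {t} → t ∈L others → t ∈L ts
    covers  : ∀ {t} → t ∈L ts → t ≡ large ⊎ t ∈L others
    shorter : length others < length ts
    exceeds : k < f large

smallOrLarge : ∀ {a} {A : Set a} (f : A → ℕ) (k : ℕ) (ts : List A) →
  All (λ t → f t ≤ k) ts ⊎ LargeEntry f k ts
smallOrLarge f k [] = inj₁ []
smallOrLarge f k (t ∷ ts) with k <? f t
... | yes big = inj₂ record
  { large = t ; others = ts ; large∈ = here refl ; others⊆ = there
  ; covers = λ { (here eq) → inj₁ eq ; (there m) → inj₂ m }
  ; shorter = ≤-refl ; exceeds = big }
... | no small with smallOrLarge f k ts
...   | inj₁ allSmall = inj₁ (≤-pred (≰⇒> small) ∷ allSmall)
...   | inj₂ L = inj₂ record
  { large = large ; others = t ∷ others ; large∈ = there large∈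
  ; others⊆ = λ { (here eq) → here eq ; (there m) → there (others⊆ m) }
  ; covers = λ { (here eq) → inj₂ (here eq) ; (there m) → map₂ there (covers m) }
  ; shorter = s≤s shorter ; exceeds = exceeds }
  where open LargeEntry L

module Counting {a} {A : Set a} (_≟_ : DecidableEquality A) where

  open DecMembership _≟_ using () renaming (_∈?_ to _∈L?_)

  private
    differentFrom : (y : A) → Decidable (_≢ y)
    differentFrom y x = ¬? (x ≟ y)

  length≤1+remove : ∀ y (xs : List A) → Unique xs →
    length xs ≤ suc (length (filter (differentFrom y) xs))
  length≤1+remove y [] _ = z≤n
  length≤1+remove y (x ∷ xs) (x∉xs ∷ xs!) with x ≟ y
  ... | yes refl rewrite filter-all (differentFrom y) (All.map (λ x≢z z≡x → x≢z (sym z≡x)) x∉xs) = ≤-refl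
  ... | no _ = s≤s (length≤1+remove y xs xs!)

  unique⊆⇒length≤ : ∀ {xs ys : List A} → Unique xs → (∀ {x} → x ∈L xs → x ∈L ys) →
    length xs ≤ length ys
  unique⊆⇒length≤ {[]}     _ _ = z≤n
  unique⊆⇒length≤ {_ ∷ _} {[]} _ sub with () ← sub (here refl)
  unique⊆⇒length≤ {xs} {y ∷ ys} xs! sub =
    ≤-trans (length≤1+remove y xs xs!)
            (s≤s (unique⊆⇒length≤ (Unique.filter⁺ (differentFrom y) xs!) sub′))
    where
    sub′ : ∀ {x} → x ∈L filter (differentFrom y) xs → x ∈L ys
    sub′ m with ∈-filter⁻ (differentFrom y) m
    ... | x∈xs , x≢y with sub x∈xs
    ...   | here x≡y   = ⊥-elim (x≢y x≡y)
    ...   | there x∈ys = x∈ys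

  unique-escape : ∀ {xs ys : List A} → Unique xs → length ys < length xs →
    ∃ λ x → x ∈L xs × x ∉L ys
  unique-escape {xs} {ys} xs! ys<xs with all-or-counterexample (_∈L? ys) xs
  ... | inj₁ xs⊆ys = ⊥-elim (<⇒≱ ys<xs (unique⊆⇒length≤ xs! (All.lookup xs⊆ys)))
  ... | inj₂ escaped = escaped

  coverBound : ∀ {b r} {T : Set b} {R : T → A → Set r} (R? : ∀ t → Decidable (R t))
    (k : ℕ) (ts : List T) {xs : List A} → Unique xs →
    (∀ {x} → x ∈L xs → Any (λ t → R t x) ts) →
    All (λ t → length (filter (R? t) xs) ≤ k) ts → length xs ≤ length ts * k
  coverBound R? k ts {xs} xs! covered small =
    ≤-trans (unique⊆⇒length≤ xs! inBlocks) (length-concatMap≤ (λ t → filter (R? t) xs) k ts small)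
    where
    inBlocks : ∀ {x} → x ∈L xs → x ∈L concatMap (λ t → filter (R? t) xs) ts
    inBlocks x∈xs = ∈-concatMap⁺ (λ t → filter (R? t) xs) (Any.map (∈-filter⁺ (R? _) x∈xs) (covered x∈xs))

subset-≟ : ∀ {n} → DecidableEquality (Subset n)
subset-≟ = Vec.≡-dec Bool._≟_

elements : ∀ {n} (p : Subset n) → Σ (List (Fin n)) λ xs →
  Unique xs × length xs ≡ ∣ p ∣ × (∀ {x} → x ∈ p → x ∈L xs) × (∀ {x} → x ∈L xs → x ∈ p)
elements [] = [] , [] , refl , (λ ()) , (λ ())
elements (s ∷ p) with elements p
... | xs , xs! , len , to , from = withHead s
  where
  sucs! : Unique (map suc xs)
  sucs! = Unique.map⁺ Fin.suc-injective xs!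
  fromSucs : ∀ {s x} → x ∈L map suc xs → x ∈ s ∷ p
  fromSucs m with ∈-map⁻ suc m
  ... | _ , m′ , refl = there (from m′)
  zero∉sucs : zero ∉L map suc xs
  zero∉sucs m with ∈-map⁻ suc m
  ... | _ , _ , ()
  withHead : (s : Bool) → Σ (List (Fin _)) λ ys → Unique ys × length ys ≡ ∣ s ∷ p ∣ ×
    (∀ {x} → x ∈ s ∷ p → x ∈L ys) × (∀ {x} → x ∈L ys → x ∈ s ∷ p)
  withHead true = zero ∷ map suc xs
    , All.tabulate (λ m eq → zero∉sucs (subst (_∈L map suc xs) (sym eq) m)) ∷ sucs!
    , cong suc (trans (length-map suc xs) len)
    , (λ { here → here refl ; (there m) → there (∈-map⁺ suc (to m)) })
    , (λ { (here refl) → here ; (there m) → fromSucs m })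
  withHead false = map suc xs , sucs! , trans (length-map suc xs) len
    , (λ { (there m) → ∈-map⁺ suc (to m) }) , fromSucs

∉∧∈⇒≢ : ∀ {n} {p : Subset n} {x y : Fin n} → x ∉ p → y ∈ p → x ≢ y
∉∧∈⇒≢ x∉ y∈ refl = x∉ y∈

OneOf3 : ∀ {n} → Fin n → Fin n → Fin n → Fin n → Set
OneOf3 x a b c = x ≡ a ⊎ x ≡ b ⊎ x ≡ c

module _ {A B C : Set} where
  swap₁₂ : A ⊎ B ⊎ C → B ⊎ A ⊎ C
  swap₁₂ (inj₁ x)        = inj₂ (inj₁ x)
  swap₁₂ (inj₂ (inj₁ x)) = inj₁ x
  swap₁₂ (inj₂ (inj₂ x)) = inj₂ (inj₂ x)

  swap₂₃ : A ⊎ B ⊎ C → A ⊎ C ⊎ B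
  swap₂₃ (inj₁ x)        = inj₁ x
  swap₂₃ (inj₂ (inj₁ x)) = inj₂ (inj₂ x)
  swap₂₃ (inj₂ (inj₂ x)) = inj₂ (inj₁ x)

  rotate : A ⊎ B ⊎ C → C ⊎ A ⊎ B
  rotate (inj₁ x)        = inj₂ (inj₁ x)
  rotate (inj₂ (inj₁ x)) = inj₂ (inj₂ x)
  rotate (inj₂ (inj₂ x)) = inj₁ x

record ThreeElements {n} (e : Subset n) : Set where
  constructor threeElements
  field
    a b c : Fin n
    a≢b   : a ≢ b
    a≢c   : a ≢ c
    b≢c   : b ≢ c
    a∈    : a ∈ e
    b∈    : b ∈ e
    c∈    : c ∈ e
    cover : ∀ {x} → x ∈ e → OneOf3 x a b c

size3⇒threeElements : ∀ {n} (e : Subset n) → ∣ e ∣ ≡ 3 → ThreeElements e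
size3⇒threeElements e size with elements e
... | a ∷ b ∷ c ∷ [] , (a∉ ∷ b∉ ∷ _) , _ , to , from =
  threeElements a b c (All.lookup a∉ (here refl)) (All.lookup a∉ (there (here refl)))
    (All.lookup b∉ (here refl)) (from (here refl)) (from (there (here refl)))
    (from (there (there (here refl)))) (oneOf ∘ to)
  where
  oneOf : ∀ {x} → x ∈L a ∷ b ∷ c ∷ [] → OneOf3 x a b c
  oneOf (here eq)                 = inj₁ eq
  oneOf (there (here eq))         = inj₂ (inj₁ eq)
  oneOf (there (there (here eq))) = inj₂ (inj₂ eq)
... | [] , _ , len , _ , _ = ⊥-elim (0≢1+n (trans len size))
... | _ ∷ [] , _ , len , _ , _ = ⊥-elim (0≢1+n (suc-injective (trans len size)))
... | _ ∷ _ ∷ [] , _ , len , _ , _ = ⊥-elim (0≢1+n (suc-injective (suc-injective (trans len size))))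
... | _ ∷ _ ∷ _ ∷ _ ∷ _ , _ , len , _ , _ =
  ⊥-elim (0≢1+n (sym (suc-injective (suc-injective (suc-injective (trans len size))))))

∈-─⁻ : ∀ {n} {p q : Subset n} {x} → x ∈ p ─ q → x ∉ q
∈-─⁻ {p = inside ∷ p} {outside ∷ q} here ()
∈-─⁻ {p = s ∷ p}      {t ∷ q}       (there m) (there m′) = ∈-─⁻ {p = p} {q} m m′

module _ {n : ℕ} where

  ∈-triple⁺ : ∀ {x a b c : Fin n} → OneOf3 x a b c → x ∈ triple a b c
  ∈-triple⁺ {a = a} {b} {c} (inj₁ refl)        = x∈p∪q⁺ (inj₁ (x∈p∪q⁺ (inj₁ (x∈⁅x⁆ a))))
  ∈-triple⁺ {a = a} {b} {c} (inj₂ (inj₁ refl)) = x∈p∪q⁺ (inj₁ (x∈p∪q⁺ (inj₂ (x∈⁅x⁆ b))))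
  ∈-triple⁺ {a = a} {b} {c} (inj₂ (inj₂ refl)) = x∈p∪q⁺ (inj₂ (x∈⁅x⁆ c))

  ∈-triple⁻ : ∀ {x a b c : Fin n} → x ∈ triple a b c → OneOf3 x a b c
  ∈-triple⁻ {a = a} {b} {c} m with x∈p∪q⁻ (⁅ a ⁆ ∪ ⁅ b ⁆) ⁅ c ⁆ m
  ... | inj₂ m′ = inj₂ (inj₂ (x∈⁅y⁆⇒x≡y c m′))
  ... | inj₁ m′ with x∈p∪q⁻ ⁅ a ⁆ ⁅ b ⁆ m′
  ...   | inj₁ m″ = inj₁ (x∈⁅y⁆⇒x≡y a m″)
  ...   | inj₂ m″ = inj₂ (inj₁ (x∈⁅y⁆⇒x≡y b m″))

  cover⇒≡triple : ∀ {e : Subset n} {a b c} → a ∈ e → b ∈ e → c ∈ e →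
    (∀ {x} → x ∈ e → OneOf3 x a b c) → e ≡ triple a b c
  cover⇒≡triple a∈ b∈ c∈ cover = ⊆-antisym (∈-triple⁺ ∘ cover) (member ∘ ∈-triple⁻)
    where
    member : ∀ {x} → OneOf3 x _ _ _ → x ∈ _
    member (inj₁ refl)        = a∈
    member (inj₂ (inj₁ refl)) = b∈
    member (inj₂ (inj₂ refl)) = c∈

  triple-rotate : ∀ {a b c : Fin n} → triple a b c ≡ triple b c a
  triple-rotate = ⊆-antisym (∈-triple⁺ ∘ rotate ∘ rotate ∘ ∈-triple⁻)
                            (∈-triple⁺ ∘ rotate ∘ ∈-triple⁻)

  triple-swap₂₃ : ∀ {a b c : Fin n} → triple a b c ≡ triple a c b
  triple-swap₂₃ = ⊆-antisym (∈-triple⁺ ∘ swap₂₃ ∘ ∈-triple⁻) (∈-triple⁺ ∘ swap₂₃ ∘ ∈-triple⁻)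

  ∈-pair⁺ : ∀ {a b x : Fin n} → x ≡ a ⊎ x ≡ b → x ∈ ⁅ a ⁆ ∪ ⁅ b ⁆
  ∈-pair⁺ {a} {b} (inj₁ refl) = x∈p∪q⁺ (inj₁ (x∈⁅x⁆ a))
  ∈-pair⁺ {a} {b} (inj₂ refl) = x∈p∪q⁺ (inj₂ (x∈⁅x⁆ b))

  ∈-pair⁻ : ∀ {a b x : Fin n} → x ∈ ⁅ a ⁆ ∪ ⁅ b ⁆ → x ≡ a ⊎ x ≡ b
  ∈-pair⁻ {a} {b} m with x∈p∪q⁻ ⁅ a ⁆ ⁅ b ⁆ m
  ... | inj₁ m′ = inj₁ (x∈⁅y⁆⇒x≡y a m′)
  ... | inj₂ m′ = inj₂ (x∈⁅y⁆⇒x≡y b m′)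

  pair-swap : ∀ {a b : Fin n} → ⁅ a ⁆ ∪ ⁅ b ⁆ ≡ ⁅ b ⁆ ∪ ⁅ a ⁆
  pair-swap = ⊆-antisym (∈-pair⁺ ∘ swap ∘ ∈-pair⁻) (∈-pair⁺ ∘ swap ∘ ∈-pair⁻)

  ∣pair∣≡2 : ∀ {a b : Fin n} → a ≢ b → ∣ ⁅ a ⁆ ∪ ⁅ b ⁆ ∣ ≡ 2
  ∣pair∣≡2 {a} {b} a≢b with elements (⁅ a ⁆ ∪ ⁅ b ⁆)
  ... | xs , xs! , len , to , from =
    trans (sym len) (≤-antisym (bound xs! (listed ∘ from)) (bound ab! (to ∘ inPair)))
    where
    open Counting Fin._≟_ renaming (unique⊆⇒length≤ to bound)
    ab! : Unique (a ∷ b ∷ [])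
    ab! = (a≢b ∷ []) ∷ [] ∷ []
    inPair : ∀ {x} → x ∈L a ∷ b ∷ [] → x ∈ ⁅ a ⁆ ∪ ⁅ b ⁆
    inPair (here eq)         = ∈-pair⁺ (inj₁ eq)
    inPair (there (here eq)) = ∈-pair⁺ (inj₂ eq)
    listed : ∀ {x} → x ∈ ⁅ a ⁆ ∪ ⁅ b ⁆ → x ∈L a ∷ b ∷ []
    listed m with ∈-pair⁻ m
    ... | inj₁ eq = here eq
    ... | inj₂ eq = there (here eq)

  ∈--⁻ : ∀ {p : Subset n} {x y} → x ∈ p - y → x ≢ y
  ∈--⁻ {p} {y = y} m = x∉⁅y⁆⇒x≢y (∈-─⁻ {p = p} {⁅ y ⁆} m)

  opaque
    subsetOf : ∀ {ℓ} {P : Fin n → Set ℓ} → Decidable P → Subset n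
    subsetOf P? = tabulate (does ∘ P?)

    ∈-subsetOf⁺ : ∀ {ℓ} {P : Fin n → Set ℓ} (P? : Decidable P) {x} → P x → x ∈ subsetOf P?
    ∈-subsetOf⁺ P? {x} Px =
      Inverse.from Vec.[]=↔lookup (trans (Vec.lookup∘tabulate _ x) (dec-true (P? x) Px))

    ∈-subsetOf⁻ : ∀ {ℓ} {P : Fin n → Set ℓ} (P? : Decidable P) {x} → x ∈ subsetOf P? → P x
    ∈-subsetOf⁻ P? {x} m with P? x | trans (sym (Vec.lookup∘tabulate _ x)) (Inverse.to Vec.[]=↔lookup m)
    ... | yes Px | _  = Px
    ... | no _   | ()

Distinct7 : ∀ {n} → (a b c d e f g : Fin n) → Set
Distinct7 a b c d e f g =
  a ≢ b × a ≢ c × a ≢ d × a ≢ e × a ≢ f × a ≢ g ×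
  b ≢ c × b ≢ d × b ≢ e × b ≢ f × b ≢ g ×
  c ≢ d × c ≢ e × c ≢ f × c ≢ g ×
  d ≢ e × d ≢ f × d ≢ g ×
  e ≢ f × e ≢ g ×
  f ≢ g

LoosePathFree : ∀ {n} → List (Subset n) → Set
LoosePathFree {n} E = ∀ (a b c d e f g : Fin n) → Distinct7 a b c d e f g →
  triple a b c ∈L E → triple c d e ∈L E → triple e f g ∈L E → ⊥

module Core {n : ℕ} (S : Subset n) (E : List (Subset n))
  (E-unique  : Unique E)
  (E-triples : ∀ {e} → e ∈L E → ∣ e ∣ ≡ 3)
  (E-inside  : ∀ {e x} → e ∈L E → x ∈ e → x ∈ S)
  (minDegree : ∀ {v} → v ∈ S → 21 ≤ length (filter (v ∈?_) E))
  (looseFree : LoosePathFree E) where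

  open Counting (subset-≟ {n})

  edgesAt : Fin n → List (Subset n)
  edgesAt v = filter (v ∈?_) E

  edgesAt-unique : ∀ v → Unique (edgesAt v)
  edgesAt-unique v = Unique.filter⁺ (v ∈?_) E-unique

  fewEdgesImpossible : ∀ {v} → v ∈ S → (M : List (Subset n)) → length M ≤ 20 →
    (∀ {e} → e ∈L E → v ∈ e → e ∈L M) → ⊥
  fewEdgesImpossible {v} v∈S M short inM =
    1+n≰n (≤-trans (minDegree v∈S) (≤-trans (unique⊆⇒length≤ (edgesAt-unique v) inM′) short))
    where
    inM′ : ∀ {e} → e ∈L edgesAt v → e ∈L M
    inM′ m = let (e∈E , v∈e) = ∈-filter⁻ (v ∈?_) m in inM e∈E v∈e

  someEdgeAt : ∀ {v} → v ∈ S → ∃ λ e → e ∈L E × v ∈ e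
  someEdgeAt {v} v∈S with edgesAt v in eq
  ... | [] = ⊥-elim (fewEdgesImpossible v∈S [] z≤n
                       (λ e∈E v∈e → subst (_ ∈L_) eq (∈-filter⁺ (v ∈?_) e∈E v∈e)))
  ... | e ∷ _ = e , ∈-filter⁻ (v ∈?_) {xs = E} (subst (e ∈L_) (sym eq) (here refl))

  record OtherTwo (e : Subset n) (v : Fin n) : Set where
    constructor otherTwo
    field
      a b   : Fin n
      a≢v   : a ≢ v
      b≢v   : b ≢ v
      a≢b   : a ≢ b
      a∈    : a ∈ e
      b∈    : b ∈ e
      cover : ∀ {x} → x ∈ e → OneOf3 x v a b

  othersOf : ∀ {e v} → e ∈L E → v ∈ e → OtherTwo e v
  othersOf {e} eE v∈e with size3⇒threeElements e (E-triples eE)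
  ... | threeElements a b c a≢b a≢c b≢c a∈ b∈ c∈ cover with cover v∈e
  ...   | inj₁ refl        = otherTwo b c (≢-sym a≢b) (≢-sym a≢c) b≢c b∈ c∈ cover
  ...   | inj₂ (inj₁ refl) = otherTwo a c a≢b (≢-sym b≢c) a≢c a∈ c∈ (swap₁₂ ∘ cover)
  ...   | inj₂ (inj₂ refl) = otherTwo a b a≢c b≢c a≢b a∈ b∈ (rotate ∘ cover)

  record ThirdVertex (e : Subset n) (u w : Fin n) : Set where
    constructor thirdVertex
    field
      s     : Fin n
      s≢u   : s ≢ u
      s≢w   : s ≢ w
      s∈    : s ∈ e
      cover : ∀ {x} → x ∈ e → OneOf3 x u w s

  thirdOf : ∀ {e u w} → e ∈L E → u ∈ e → w ∈ e → u ≢ w → ThirdVertex e u w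
  thirdOf eE u∈e w∈e u≢w with othersOf eE u∈e
  ... | otherTwo a b a≢u b≢u a≢b a∈ b∈ cover with cover w∈e
  ...   | inj₁ w≡u         = ⊥-elim (u≢w (sym w≡u))
  ...   | inj₂ (inj₁ refl) = thirdVertex b b≢u (≢-sym a≢b) b∈ cover
  ...   | inj₂ (inj₂ refl) = thirdVertex a a≢u a≢b a∈ (swap₂₃ ∘ cover)

  edge≡triple : ∀ {e} {a b c : Fin n} → e ∈L E → a ∈ e → b ∈ e → c ∈ e →
    a ≢ b → a ≢ c → b ≢ c → e ≡ triple a b c
  edge≡triple eE a∈ b∈ c∈ a≢b a≢c b≢c with thirdOf eE a∈ b∈ a≢b
  ... | thirdVertex t _ _ _ cover with cover c∈
  ...   | inj₁ c≡a         = ⊥-elim (a≢c (sym c≡a))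
  ...   | inj₂ (inj₁ c≡b)  = ⊥-elim (b≢c (sym c≡b))
  ...   | inj₂ (inj₂ refl) = cover⇒≡triple a∈ b∈ c∈ cover

  triple∈E : ∀ {e} {a b c : Fin n} → e ∈L E → a ∈ e → b ∈ e → c ∈ e →
    a ≢ b → a ≢ c → b ≢ c → triple a b c ∈L E
  triple∈E eE a∈ b∈ c∈ a≢b a≢c b≢c = subst (_∈L E) (edge≡triple eE a∈ b∈ c∈ a≢b a≢c b≢c) eE

  Partner : Fin n → Fin n → Set
  Partner u c = c ≢ u × (∀ {e} → e ∈L E → u ∈ e → c ∈ e)

  HasPartner : Fin n → Set
  HasPartner u = ∃ (Partner u)

  onAllEdgesOrMissed : ∀ u c →
    (∀ {e} → e ∈L E → u ∈ e → c ∈ e) ⊎ (∃ λ e → e ∈L E × u ∈ e × c ∉ e)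
  onAllEdgesOrMissed u c with all-or-counterexample (λ e → u ∈? e →-dec c ∈? e) E
  ... | inj₁ onAll = inj₁ (All.lookup onAll)
  ... | inj₂ (e , e∈E , ¬onE) = inj₂ (e , e∈E , u∈e , λ c∈e → ¬onE (λ _ → c∈e))
    where
    u∈e : u ∈ e
    u∈e = decidable-stable (u ∈? e) (λ u∉e → ¬onE (λ u∈e → ⊥-elim (u∉e u∈e)))

  partner? : ∀ u c → Dec (Partner u c)
  partner? u c with onAllEdgesOrMissed u c
  ... | inj₁ onAll = map′ (_, onAll) proj₁ (¬? (c Fin.≟ u))
  ... | inj₂ (e , e∈E , u∈e , c∉e) = no (λ (_ , onAll) → c∉e (onAll e∈E u∈e))

  hasPartner? : ∀ u → Dec (HasPartner u)
  hasPartner? u = Fin.any? (partner? u)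

  partner∈S : ∀ {v c} → v ∈ S → Partner v c → c ∈ S
  partner∈S v∈S (_ , onAll) with someEdgeAt v∈S
  ... | e , eE , v∈e = E-inside eE (onAll eE v∈e)

  -- Two distinct vertices on every edge through v ∈ S would leave v a single edge.
  twoForcedImpossible : ∀ {v a b} → v ∈ S → a ≢ v → b ≢ v → a ≢ b →
    (∀ {e} → e ∈L E → v ∈ e → a ∈ e × b ∈ e) → ⊥
  twoForcedImpossible v∈S a≢v b≢v a≢b forced =
    fewEdgesImpossible v∈S (triple _ _ _ ∷ []) (s≤s z≤n) λ eE v∈e →
      let (a∈e , b∈e) = forced eE v∈e
      in here (edge≡triple eE v∈e a∈e b∈e (≢-sym a≢v) (≢-sym b≢v) a≢b)

  partner-unique : ∀ {v c c′} → v ∈ S → Partner v c → Partner v c′ → c ≡ c′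
  partner-unique {c = c} {c′} v∈S (c≢v , onAll) (c′≢v , onAll′) with c Fin.≟ c′
  ... | yes c≡c′ = c≡c′
  ... | no c≢c′  = ⊥-elim (twoForcedImpossible v∈S c≢v c′≢v c≢c′ (λ eE v∈e → onAll eE v∈e , onAll′ eE v∈e))

  partner-mutual : ∀ {v c d} → v ∈ S → Partner v c → Partner c d → d ≡ v
  partner-mutual {v} {c} {d} v∈S (c≢v , onAll) (d≢c , onAll′) with d Fin.≟ v
  ... | yes d≡v = d≡v
  ... | no d≢v  = ⊥-elim (twoForcedImpossible v∈S c≢v d≢v (≢-sym d≢c)
                           (λ eE v∈e → onAll eE v∈e , onAll′ eE (onAll eE v∈e)))

  codegree : Fin n → Fin n → ℕ
  codegree u p = length (filter (p ∈?_) (edgesAt u))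

  record HeavyCover (u : Fin n) : Set where
    field
      p        : Fin n
      qs       : List (Fin n)
      qs-short : length qs ≤ 3
      p≢u      : p ≢ u
      qs≢u     : ∀ {q} → q ∈L qs → q ≢ u
      heavy    : 5 < codegree u p
      cover    : ∀ {e} → e ∈L E → u ∈ e → p ∈ e ⊎ Any (_∈ e) qs

  -- Pigeonhole: of at most four vertices meeting all edges through u ∈ S, one
  -- shares more than five of them, since u lies on at least 21 > 4·5 edges.
  heavyCover : ∀ {u} → u ∈ S → (ts : List (Fin n)) → length ts ≤ 4 →
    (∀ {t} → t ∈L ts → t ≢ u) → (∀ {e} → e ∈L E → u ∈ e → Any (_∈ e) ts) → HeavyCover u
  heavyCover {u} u∈S ts short ts≢u meets with smallOrLarge (codegree u) 5 ts
  ... | inj₁ allSmall =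
    ⊥-elim (1+n≰n (≤-trans (minDegree u∈S) (≤-trans degreeBound (*-monoˡ-≤ 5 short))))
    where
    degreeBound : length (edgesAt u) ≤ length ts * 5
    degreeBound = coverBound (λ t → t ∈?_) 5 ts (edgesAt-unique u)
      (λ m → let (e∈E , u∈e) = ∈-filter⁻ (u ∈?_) m in meets e∈E u∈e) allSmall
  ... | inj₂ L = record
    { p = large ; qs = others ; qs-short = ≤-pred (≤-trans shorter short)
    ; p≢u = ts≢u large∈ ; qs≢u = ts≢u ∘ others⊆ ; heavy = exceeds ; cover = cover }
    where
    open LargeEntry L
    cover : ∀ {e} → e ∈L E → u ∈ e → large ∈ e ⊎ Any (_∈ e) others
    cover eE u∈e with find (meets eE u∈e)
    ... | t , t∈ts , t∈e with covers t∈ts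
    ...   | inj₁ refl       = inj₁ t∈e
    ...   | inj₂ t∈others = inj₂ (lose t∈others t∈e)

  record EdgeAvoiding (u p : Fin n) (excluded : List (Fin n)) : Set where
    constructor edgeAvoiding
    field
      s    : Fin n
      s≢u  : s ≢ u
      s≢p  : s ≢ p
      s∉   : s ∉L excluded
      edge : triple u p s ∈L E

  opaque
    avoidingEdge : ∀ {u p} → p ≢ u → 5 < codegree u p → (excluded : List (Fin n)) →
      length excluded ≤ 5 → EdgeAvoiding u p excluded
    avoidingEdge {u} {p} p≢u heavy excluded short
      with unique-escape {xs = filter (p ∈?_) (edgesAt u)} {ys = map (triple u p) excluded}
             (Unique.filter⁺ (p ∈?_) (edgesAt-unique u))
             (≤-trans (s≤s (≤-trans (≤-reflexive (length-map (triple u p) excluded)) short)) heavy)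
    ... | e , e∈ , e∉ with ∈-filter⁻ (p ∈?_) {xs = edgesAt u} e∈
    ...   | e∈u , p∈e with ∈-filter⁻ (u ∈?_) {xs = E} e∈u
    ...     | eE , u∈e with thirdOf eE u∈e p∈e (≢-sym p≢u)
    ...       | thirdVertex s s≢u s≢p s∈e cover =
      edgeAvoiding s s≢u s≢p
        (λ s∈ → e∉ (subst (_∈L map (triple u p) excluded) (sym e≡) (∈-map⁺ (triple u p) s∈)))
        (subst (_∈L E) e≡ eE)
      where
      e≡ : e ≡ triple u p s
      e≡ = cover⇒≡triple u∈e p∈e s∈e cover

  -- Let p be heavy for u and let the edge
  -- {u,a,b} miss p; let {u,p,s} be an edge with s ∉ qs ∪ {a,b}.  Every edge
  -- through s is then one of the at most seven triples in M (all others close a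
  -- loose path), contradicting the degree of s.
  module HeavyMissingEdge {u} (H : HeavyCover u) {a b : Fin n}
    (a≢u : a ≢ u) (b≢u : b ≢ u) (a≢b : a ≢ b) (uab∈E : triple u a b ∈L E)
    (p∉uab : HeavyCover.p H ∉ triple u a b)
    (U : EdgeAvoiding u (HeavyCover.p H) (HeavyCover.qs H ++ a ∷ b ∷ [])) where

    open HeavyCover H
    open EdgeAvoiding U

    p≢a : p ≢ a
    p≢a = ∉∧∈⇒≢ p∉uab (∈-triple⁺ (inj₂ (inj₁ refl)))

    p≢b : p ≢ b
    p≢b = ∉∧∈⇒≢ p∉uab (∈-triple⁺ (inj₂ (inj₂ refl)))

    s≢a : s ≢ a
    s≢a = ∉L∧∈L⇒≢ s∉ (∈-++⁺ʳ qs (here refl))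

    s≢b : s ≢ b
    s≢b = ∉L∧∈L⇒≢ s∉ (∈-++⁺ʳ qs (there (here refl)))

    s≢q : ∀ {q} → q ∈L qs → s ≢ q
    s≢q q∈qs = ∉L∧∈L⇒≢ s∉ (∈-++⁺ˡ q∈qs)

    M : List (Subset n)
    M = triple u s p ∷ map (triple u s) qs ++ triple s p a ∷ triple s p b ∷ triple s a b ∷ []

    M-short : length M ≤ 20
    M-short = s≤s (≤-trans
      (≤-reflexive (trans (length-++ (map (triple u s) qs)) (cong (_+ 3) (length-map (triple u s) qs))))
      (≤-trans (+-monoˡ-≤ 3 qs-short) (m≤m+n 6 13)))

    lastThree∈M : ∀ {t} → t ∈L triple s p a ∷ triple s p b ∷ triple s a b ∷ [] → t ∈L M
    lastThree∈M = there ∘ ∈-++⁺ʳ (map (triple u s) qs)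

    -- Edges through s and u contain p or some q ∈ qs.
    edgeThroughU : ∀ {f} → f ∈L E → s ∈ f → u ∈ f → f ∈L M
    edgeThroughU fE s∈f u∈f with cover fE u∈f
    ... | inj₁ p∈f = here (edge≡triple fE u∈f s∈f p∈f (≢-sym s≢u) (≢-sym p≢u) s≢p)
    ... | inj₂ meetsQs with find meetsQs
    ...   | q , q∈qs , q∈f = there (∈-++⁺ˡ (subst (_∈L map (triple u s) qs)
              (sym (edge≡triple fE u∈f s∈f q∈f (≢-sym s≢u) (≢-sym (qs≢u q∈qs)) (s≢q q∈qs)))
              (∈-map⁺ (triple u s) q∈qs)))

    -- An edge {s,p,z} avoiding u has z ∈ {a,b}, or {s,z,p},{p,s′,u},{u,a,b} is a loose path.
    edgeThroughP : ∀ {f} → f ∈L E → s ∈ f → u ∉ f → p ∈ f → f ∈L M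
    edgeThroughP fE s∈f u∉f p∈f with thirdOf fE s∈f p∈f s≢p
    ... | thirdVertex z z≢s z≢p z∈f cover with z Fin.≟ a | z Fin.≟ b
    ...   | yes refl | _ = lastThree∈M (here (edge≡triple fE s∈f p∈f z∈f s≢p s≢a p≢a))
    ...   | no _ | yes refl = lastThree∈M (there (here (edge≡triple fE s∈f p∈f z∈f s≢p s≢b p≢b)))
    ...   | no z≢a | no z≢b
      with avoidingEdge p≢u heavy (s ∷ z ∷ a ∷ b ∷ []) (s≤s (s≤s (s≤s (s≤s z≤n))))
    ...     | edgeAvoiding s′ s′≢u s′≢p s′∉ ups′∈E = ⊥-elim (looseFree s z p s′ u a b
      ( ≢-sym z≢s , s≢p , ≢-sym (∉L∧∈L⇒≢ s′∉ (here refl)) , s≢u , s≢a , s≢b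
      , z≢p , ≢-sym (∉L∧∈L⇒≢ s′∉ (there (here refl))) , ≢-sym (∉∧∈⇒≢ u∉f z∈f) , z≢a , z≢b
      , ≢-sym s′≢p , p≢u , p≢a , p≢b
      , s′≢u , ∉L∧∈L⇒≢ s′∉ (there (there (here refl))) , ∉L∧∈L⇒≢ s′∉ (there (there (there (here refl))))
      , ≢-sym a≢u , ≢-sym b≢u
      , a≢b )
      (triple∈E fE s∈f z∈f p∈f (≢-sym z≢s) s≢p z≢p) (subst (_∈L E) triple-rotate ups′∈E) uab∈E)

    -- An edge {x,s,z} through exactly one of a, b (x ∈ f, y ∉ f) closes the
    -- loose path {p,s′,u},{u,y,x},{x,s,z}.
    oneOfPairImpossible : ∀ {f x y} → f ∈L E → s ∈ f → u ∉ f → p ∉ f → x ∈ f → y ∉ f →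
      x ≢ u → y ≢ u → y ≢ x → p ≢ x → p ≢ y → s ≢ x → s ≢ y → triple u y x ∈L E → ⊥
    oneOfPairImpossible fE s∈f u∉f p∉f x∈f y∉f x≢u y≢u y≢x p≢x p≢y s≢x s≢y uyx∈E
      with thirdOf fE x∈f s∈f (≢-sym s≢x)
    ... | thirdVertex z z≢x z≢s z∈f _
      with avoidingEdge p≢u heavy (_ ∷ _ ∷ s ∷ z ∷ []) (s≤s (s≤s (s≤s (s≤s z≤n))))
    ...   | edgeAvoiding s′ s′≢u s′≢p s′∉ ups′∈E = looseFree p s′ u _ _ s z
      ( ≢-sym s′≢p , p≢u , p≢y , p≢x , ≢-sym s≢p , ∉∧∈⇒≢ p∉f z∈f
      , s′≢u , ∉L∧∈L⇒≢ s′∉ (there (here refl)) , ∉L∧∈L⇒≢ s′∉ (here refl)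
        , ∉L∧∈L⇒≢ s′∉ (there (there (here refl))) , ∉L∧∈L⇒≢ s′∉ (there (there (there (here refl))))
      , ≢-sym y≢u , ≢-sym x≢u , ≢-sym s≢u , ∉∧∈⇒≢ u∉f z∈f
      , y≢x , ≢-sym s≢y , ∉∧∈⇒≢ y∉f z∈f
      , ≢-sym s≢x , ≢-sym z≢x
      , ≢-sym z≢s )
      (subst (_∈L E) triple-rotate ups′∈E) uyx∈E
      (triple∈E fE x∈f s∈f z∈f (≢-sym s≢x) (≢-sym z≢x) (≢-sym z≢s))

    -- An edge {s,x,y} avoiding u, p, a, b closes the loose path {a,b,u},{u,p,s},{s,x,y}.
    avoidingAllImpossible : ∀ {f} → f ∈L E → s ∈ f → u ∉ f → p ∉ f → a ∉ f → b ∉ f → ⊥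
    avoidingAllImpossible fE s∈f u∉f p∉f a∉f b∉f with othersOf fE s∈f
    ... | otherTwo x y x≢s y≢s x≢y x∈f y∈f _ = looseFree a b u p s x y
      ( a≢b , a≢u , ≢-sym p≢a , ≢-sym s≢a , ∉∧∈⇒≢ a∉f x∈f , ∉∧∈⇒≢ a∉f y∈f
      , b≢u , ≢-sym p≢b , ≢-sym s≢b , ∉∧∈⇒≢ b∉f x∈f , ∉∧∈⇒≢ b∉f y∈f
      , ≢-sym p≢u , ≢-sym s≢u , ∉∧∈⇒≢ u∉f x∈f , ∉∧∈⇒≢ u∉f y∈f
      , ≢-sym s≢p , ∉∧∈⇒≢ p∉f x∈f , ∉∧∈⇒≢ p∉f y∈f
      , ≢-sym x≢s , ≢-sym y≢s
      , x≢y )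
      (subst (_∈L E) triple-rotate uab∈E) edge (triple∈E fE s∈f x∈f y∈f (≢-sym x≢s) (≢-sym y≢s) x≢y)

    edgesAtS : ∀ {f} → f ∈L E → s ∈ f → f ∈L M
    edgesAtS {f} fE s∈f with u ∈? f | p ∈? f | a ∈? f | b ∈? f
    ... | yes u∈f | _       | _       | _       = edgeThroughU fE s∈f u∈f
    ... | no u∉f  | yes p∈f | _       | _       = edgeThroughP fE s∈f u∉f p∈f
    ... | no _    | no _    | yes a∈f | yes b∈f =
      lastThree∈M (there (there (here (edge≡triple fE s∈f a∈f b∈f s≢a s≢b a≢b))))
    ... | no u∉f  | no p∉f  | yes a∈f | no b∉f  = ⊥-elim (oneOfPairImpossible fE s∈f u∉f p∉f a∈f b∉f
      a≢u b≢u (≢-sym a≢b) p≢a p≢b s≢a s≢b (subst (_∈L E) triple-swap₂₃ uab∈E))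
    ... | no u∉f  | no p∉f  | no a∉f  | yes b∈f = ⊥-elim (oneOfPairImpossible fE s∈f u∉f p∉f b∈f a∉f
      b≢u a≢u a≢b p≢b p≢a s≢b s≢a uab∈E)
    ... | no u∉f  | no p∉f  | no a∉f  | no b∉f  = ⊥-elim (avoidingAllImpossible fE s∈f u∉f p∉f a∉f b∉f)

    impossible : ⊥
    impossible = fewEdgesImpossible (E-inside edge (∈-triple⁺ (inj₂ (inj₂ refl)))) M M-short edgesAtS

  transversal⇒partner : ∀ {u} → u ∈ S → (ts : List (Fin n)) → length ts ≤ 4 →
    (∀ {t} → t ∈L ts → t ≢ u) → (∀ {e} → e ∈L E → u ∈ e → Any (_∈ e) ts) → HasPartner u
  transversal⇒partner {u} u∈S ts short ts≢u meets with heavyCover u∈S ts short ts≢u meets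
  ... | H with onAllEdgesOrMissed u (HeavyCover.p H)
  ...   | inj₁ onAll = HeavyCover.p H , HeavyCover.p≢u H , onAll
  ...   | inj₂ (e , eE , u∈e , p∉e) with othersOf eE u∈e
  ...     | otherTwo a b a≢u b≢u a≢b a∈e b∈e cover =
    ⊥-elim (HeavyMissingEdge.impossible H a≢u b≢u a≢b (subst (_∈L E) e≡ eE)
              (subst (HeavyCover.p H ∉_) e≡ p∉e)
              (avoidingEdge (HeavyCover.p≢u H) (HeavyCover.heavy H) (HeavyCover.qs H ++ a ∷ b ∷ [])
                 (≤-trans (≤-reflexive (length-++ (HeavyCover.qs H))) (+-monoˡ-≤ 2 (HeavyCover.qs-short H)))))
    where
    e≡ : e ≡ triple u a b
    e≡ = cover⇒≡triple u∈e a∈e b∈e cover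

  module Partnerless {u} (u∈S : u ∈ S) (noPartner : ¬ HasPartner u) where

    -- Let t be the third vertex of an edge g ⊇ {u,w}.  Every edge f = {w,x,y}
    -- avoiding u contains t: otherwise w, t, x, y do not meet every edge through
    -- the partnerless u, and an edge {u,c,d} avoiding them closes the loose
    -- path {c,d,u},{u,t,w},{w,x,y}.
    thirdOnEdgesAvoidingU : ∀ {w f g} → u ≢ w → f ∈L E → w ∈ f → u ∉ f →
      g ∈L E → u ∈ g → w ∈ g → (T : ThirdVertex g u w) → ThirdVertex.s T ∈ f
    thirdOnEdgesAvoidingU {w} {f} {g} u≢w fE w∈f u∉f gE u∈g w∈g (thirdVertex t t≢u t≢w t∈g _)
      with t ∈? f
    ... | yes t∈f = t∈f
    ... | no t∉f with othersOf fE w∈f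
    ...   | otherTwo x y x≢w y≢w x≢y x∈f y∈f _ =
      missedEdge (all-or-counterexample (λ h → u ∈? h →-dec any? (_∈? h) ts) E)
      where
      ts : List (Fin n)
      ts = w ∷ t ∷ x ∷ y ∷ []

      ts≢u : ∀ {v} → v ∈L ts → v ≢ u
      ts≢u (here refl)                         = ≢-sym u≢w
      ts≢u (there (here refl))                 = t≢u
      ts≢u (there (there (here refl)))         = ≢-sym (∉∧∈⇒≢ u∉f x∈f)
      ts≢u (there (there (there (here refl)))) = ≢-sym (∉∧∈⇒≢ u∉f y∈f)

      missedEdge : All (λ h → u ∈ h → Any (_∈ h) ts) E
                   ⊎ (∃ λ h → h ∈L E × ¬ (u ∈ h → Any (_∈ h) ts)) → t ∈ f
      missedEdge (inj₁ meets) =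
        ⊥-elim (noPartner (transversal⇒partner u∈S ts ≤-refl ts≢u (All.lookup meets)))
      missedEdge (inj₂ (h , hE , ¬meets)) = loosePath (othersOf hE u∈h)
        where
        u∈h : u ∈ h
        u∈h = decidable-stable (u ∈? h) (λ u∉h → ¬meets (λ u∈h → ⊥-elim (u∉h u∈h)))

        off : ∀ {z v} → z ∈ h → v ∈L ts → z ≢ v
        off z∈h v∈ts refl = ¬meets (λ _ → lose v∈ts z∈h)

        loosePath : OtherTwo h u → t ∈ f
        loosePath (otherTwo c d c≢u d≢u c≢d c∈h d∈h _) = ⊥-elim (looseFree c d u t w x y
          ( c≢d , c≢u , off c∈h (there (here refl)) , off c∈h (here refl)
            , off c∈h (there (there (here refl))) , off c∈h (there (there (there (here refl))))
          , d≢u , off d∈h (there (here refl)) , off d∈h (here refl)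
            , off d∈h (there (there (here refl))) , off d∈h (there (there (there (here refl))))
          , ≢-sym t≢u , u≢w , ∉∧∈⇒≢ u∉f x∈f , ∉∧∈⇒≢ u∉f y∈f
          , t≢w , ∉∧∈⇒≢ t∉f x∈f , ∉∧∈⇒≢ t∉f y∈f
          , ≢-sym x≢w , ≢-sym y≢w
          , x≢y )
          (subst (_∈L E) triple-rotate (triple∈E hE u∈h c∈h d∈h (≢-sym c≢u) (≢-sym d≢u) c≢d))
          (triple∈E gE u∈g t∈g w∈g (≢-sym t≢u) u≢w t≢w)
          (triple∈E fE w∈f x∈f y∈f (≢-sym x≢w) (≢-sym y≢w) x≢y))

    -- If the edges {u,w,t} and {u,w,s} differ and some edge f₀ through w avoids
    -- u, then every edge through w is {u,w,t}, {u,w,s} or {w,t,s}: too few for w.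
    twoEdgesImpossible : ∀ {w e g f₀} → u ≢ w → e ∈L E → u ∈ e → w ∈ e →
      g ∈L E → u ∈ g → w ∈ g → (T : ThirdVertex e u w) (T′ : ThirdVertex g u w) →
      ThirdVertex.s T ∉ g → f₀ ∈L E → w ∈ f₀ → u ∉ f₀ → ⊥
    twoEdgesImpossible {w} {e} {g} {f₀} u≢w eE u∈e w∈e gE u∈g w∈g
      T@(thirdVertex t t≢u t≢w _ _) T′@(thirdVertex s s≢u s≢w s∈g _) t∉g f₀E w∈f₀ u∉f₀ =
      fewEdgesImpossible (E-inside eE w∈e) (triple u w t ∷ triple u w s ∷ triple w t s ∷ [])
        (s≤s (s≤s (s≤s z≤n))) edgesAtW
      where
      t≢s : t ≢ s
      t≢s = ∉∧∈⇒≢ t∉g s∈g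

      tsOnEdgesAvoidingU : ∀ {h} → h ∈L E → w ∈ h → u ∉ h → h ≡ triple w t s
      tsOnEdgesAvoidingU hE w∈h u∉h = edge≡triple hE w∈h
        (thirdOnEdgesAvoidingU u≢w hE w∈h u∉h eE u∈e w∈e T)
        (thirdOnEdgesAvoidingU u≢w hE w∈h u∉h gE u∈g w∈g T′) (≢-sym t≢w) (≢-sym s≢w) t≢s

      edgesAtW : ∀ {h} → h ∈L E → w ∈ h → h ∈L triple u w t ∷ triple u w s ∷ triple w t s ∷ []
      edgesAtW {h} hE w∈h with u ∈? h
      ... | no u∉h = there (there (here (tsOnEdgesAvoidingU hE w∈h u∉h)))
      ... | yes u∈h with thirdOf hE u∈h w∈h u≢w
      ...   | R@(thirdVertex r _ r≢w r∈h _)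
        with ∈-triple⁻ (subst (r ∈_) (tsOnEdgesAvoidingU f₀E w∈f₀ u∉f₀)
                          (thirdOnEdgesAvoidingU u≢w f₀E w∈f₀ u∉f₀ hE u∈h w∈h R))
      ...     | inj₁ r≡w         = ⊥-elim (r≢w r≡w)
      ...     | inj₂ (inj₁ refl) = here (edge≡triple hE u∈h w∈h r∈h u≢w (≢-sym t≢u) (≢-sym t≢w))
      ...     | inj₂ (inj₂ refl) = there (here (edge≡triple hE u∈h w∈h r∈h u≢w (≢-sym s≢u) (≢-sym s≢w)))

    -- Every vertex sharing an edge {u,w,t} with the partnerless u has a partner:
    -- if neither u nor t is one, an edge through w avoiding t must contain u,
    -- and twoEdgesImpossible applies.
    neighbourHasPartner : ∀ {w e} → u ≢ w → e ∈L E → u ∈ e → w ∈ e → HasPartner w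
    neighbourHasPartner {w} u≢w eE u∈e w∈e with onAllEdgesOrMissed w u
    ... | inj₁ onAll = u , u≢w , onAll
    ... | inj₂ (f₀ , f₀E , w∈f₀ , u∉f₀) with thirdOf eE u∈e w∈e u≢w
    ...   | T@(thirdVertex t _ t≢w _ _) with onAllEdgesOrMissed w t
    ...     | inj₁ onAll = t , t≢w , onAll
    ...     | inj₂ (g , gE , w∈g , t∉g) with u ∈? g
    ...       | no u∉g  = ⊥-elim (t∉g (thirdOnEdgesAvoidingU u≢w gE w∈g u∉g eE u∈e w∈e T))
    ...       | yes u∈g = ⊥-elim (twoEdgesImpossible u≢w eE u∈e w∈e gE u∈g w∈g
                                     T (thirdOf gE u∈g w∈g u≢w) t∉g f₀E w∈f₀ u∉f₀)

  -- Every edge has a partnerless vertex.  Otherwise take a vertex a of the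
  -- edge, its partner c (on the edge) and the third vertex r: the partner of r
  -- lies on the edge, but is neither a nor c by mutuality.
  partnerlessVertexOf : ∀ {e} → e ∈L E → ∃ λ y → y ∈ e × ¬ HasPartner y
  partnerlessVertexOf {e} eE with Fin.any? (λ y → y ∈? e ×-dec ¬? (hasPartner? y))
  ... | yes found = found
  ... | no none   = ⊥-elim (allPartnered (ThreeElements.a∈ (size3⇒threeElements e (E-triples eE))))
    where
    partnered : ∀ {x} → x ∈ e → HasPartner x
    partnered {x} x∈e = decidable-stable (hasPartner? x) (λ np → none (x , x∈e , np))

    allPartnered : ∀ {a} → a ∈ e → ⊥
    allPartnered {a} a∈e with partnered a∈e
    ... | c , a↔c with thirdOf eE a∈e (proj₂ a↔c eE a∈e) (≢-sym (proj₁ a↔c))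
    ...   | thirdVertex r r≢a r≢c r∈e cover with partnered r∈e
    ...     | d , r↔d with cover (proj₂ r↔d eE r∈e)
    ...       | inj₁ refl        = r≢c (sym (partner-mutual (E-inside eE r∈e) r↔d a↔c))
    ...       | inj₂ (inj₂ d≡r)  = proj₁ r↔d d≡r
    ...       | inj₂ (inj₁ refl) = r≢a (sym (partner-mutual (E-inside eE r∈e) r↔d c↔a))
      where
      c↔a : Partner c a
      c↔a with partnered (proj₂ a↔c eE a∈e)
      ... | d′ , c↔d′ = subst (Partner c) (partner-mutual (E-inside eE a∈e) a↔c c↔d′) c↔d′

  IsY : Fin n → Set
  IsY v = v ∈ S × ¬ HasPartner v

  IsX : Fin n → Set
  IsX v = v ∈ S × ∃ λ c → Partner v c × HasPartner c

  IsZ : Fin n → Set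
  IsZ v = v ∈ S × ∃ λ c → Partner v c × ¬ HasPartner c

  isY? : Decidable IsY
  isY? v = v ∈? S ×-dec ¬? (hasPartner? v)

  isX? : Decidable IsX
  isX? v = v ∈? S ×-dec Fin.any? (λ c → partner? v c ×-dec hasPartner? c)

  isZ? : Decidable IsZ
  isZ? v = v ∈? S ×-dec Fin.any? (λ c → partner? v c ×-dec ¬? (hasPartner? c))

  X Y Z : Subset n
  X = subsetOf isX?
  Y = subsetOf isY?
  Z = subsetOf isZ?

  InA : Fin n → Fin n → Set
  InA y z = z ∈ S × Partner z y

  inA? : ∀ y → Decidable (InA y)
  inA? y z = z ∈? S ×-dec partner? z y

  A-of : Fin n → Subset n
  A-of y = subsetOf (inA? y)

  opaque
    partnerOf : Fin n → Fin n
    partnerOf v with hasPartner? v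
    ... | yes (c , _) = c
    ... | no _        = v

    partnerOf-spec : ∀ {v c} → v ∈ S → Partner v c → partnerOf v ≡ c
    partnerOf-spec {v} v∈S v↔c with hasPartner? v
    ... | yes (_ , v↔c′) = partner-unique v∈S v↔c′ v↔c
    ... | no none        = ⊥-elim (none (_ , v↔c))

  record PairedVertex (x : Fin n) : Set where
    field
      x↔         : Partner x (partnerOf x)
      involutive : partnerOf (partnerOf x) ≡ x
      partner∈X  : IsX (partnerOf x)

  pairedVertex : ∀ {x} → IsX x → PairedVertex x
  pairedVertex {x} (x∈S , c , x↔c , d , c↔d) = record
    { x↔ = x↔ ; involutive = partnerOf-spec c∈S ↔x
    ; partner∈X = c∈S , x , ↔x , partnerOf x , x↔ }
    where
    partnerOf≡c : partnerOf x ≡ c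
    partnerOf≡c = partnerOf-spec x∈S x↔c
    x↔ : Partner x (partnerOf x)
    x↔ = subst (Partner x) (sym partnerOf≡c) x↔c
    ↔x : Partner (partnerOf x) x
    ↔x = subst₂ Partner (sym partnerOf≡c) (partner-mutual x∈S x↔c c↔d) c↔d
    c∈S : partnerOf x ∈ S
    c∈S = partner∈S x∈S x↔

  -- The pairs {x, partner x} of X, each listed once through its smaller element.
  IsRepresentative : Fin n → Set
  IsRepresentative v = IsX v × toℕ v < toℕ (partnerOf v)

  isRepresentative? : Decidable IsRepresentative
  isRepresentative? v = isX? v ×-dec toℕ v <? toℕ (partnerOf v)

  opaque
    representatives : List (Fin n)
    representatives = filter isRepresentative? (allFin n)

  pairCount : ℕ
  pairCount = length representatives

  representative : Fin pairCount → Fin n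
  representative = lookup representatives

  pair : Fin pairCount → Subset n
  pair i = ⁅ representative i ⁆ ∪ ⁅ partnerOf (representative i) ⁆

  opaque
    unfolding representatives

    representatives-unique : Unique representatives
    representatives-unique = Unique.filter⁺ isRepresentative? (Unique.allFin⁺ n)

    representative-isRep : ∀ i → IsRepresentative (representative i)
    representative-isRep i = proj₂ (∈-filter⁻ isRepresentative? {xs = allFin n}
                                      (∈-lookup {xs = representatives} i))

    representativeIndex : ∀ {r} → IsRepresentative r → ∃ λ i → representative i ≡ r
    representativeIndex {r} isRep = Any.index r∈ , sym (lookup-index r∈)
      where
      r∈ : r ∈L representatives
      r∈ = ∈-filter⁺ isRepresentative? (∈-allFin r) isRep

  pairIndex : ∀ {x} → IsX x → ∃ λ i → pair i ≡ ⁅ x ⁆ ∪ ⁅ partnerOf x ⁆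
  pairIndex {x} x∈X with toℕ x <? toℕ (partnerOf x)
  ... | yes x<c = let (i , eq) = representativeIndex (x∈X , x<c) in
                  i , cong (λ r → ⁅ r ⁆ ∪ ⁅ partnerOf r ⁆) eq
  ... | no x≮c = viaPartner (representativeIndex (partner∈X , c<cc))
    where
    open PairedVertex (pairedVertex x∈X)
    open ≡-Reasoning

    c<cc : toℕ (partnerOf x) < toℕ (partnerOf (partnerOf x))
    c<cc = subst (λ w → toℕ (partnerOf x) < toℕ w) (sym involutive)
             (≤∧≢⇒< (≮⇒≥ x≮c) (λ eq → proj₁ x↔ (Fin.toℕ-injective eq)))

    viaPartner : (∃ λ i → representative i ≡ partnerOf x) →
                 ∃ λ i → pair i ≡ ⁅ x ⁆ ∪ ⁅ partnerOf x ⁆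
    viaPartner (i , eq) = i , (begin
      pair i                                        ≡⟨ cong (λ r → ⁅ r ⁆ ∪ ⁅ partnerOf r ⁆) eq ⟩
      ⁅ partnerOf x ⁆ ∪ ⁅ partnerOf (partnerOf x) ⁆ ≡⟨ cong (λ w → ⁅ partnerOf x ⁆ ∪ ⁅ w ⁆) involutive ⟩
      ⁅ partnerOf x ⁆ ∪ ⁅ x ⁆                       ≡⟨ pair-swap ⟩
      ⁅ x ⁆ ∪ ⁅ partnerOf x ⁆                       ∎)

  partition₃ : Partition3 S X Y Z
  partition₃ = ⊆-antisym inS fromS , disjointXY , disjointXZ , disjointYZ
    where
    inS : ∀ {x} → x ∈ (X ∪ Y) ∪ Z → x ∈ S
    inS m with x∈p∪q⁻ (X ∪ Y) Z m
    ... | inj₂ x∈Z = proj₁ (∈-subsetOf⁻ isZ? x∈Z)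
    ... | inj₁ m′ with x∈p∪q⁻ X Y m′
    ...   | inj₁ x∈X = proj₁ (∈-subsetOf⁻ isX? x∈X)
    ...   | inj₂ x∈Y = proj₁ (∈-subsetOf⁻ isY? x∈Y)

    fromS : ∀ {x} → x ∈ S → x ∈ (X ∪ Y) ∪ Z
    fromS {x} x∈S with hasPartner? x
    ... | no noPartner = x∈p∪q⁺ (inj₁ (x∈p∪q⁺ (inj₂ (∈-subsetOf⁺ isY? (x∈S , noPartner)))))
    ... | yes (c , x↔c) with hasPartner? c
    ...   | yes c↔ = x∈p∪q⁺ (inj₁ (x∈p∪q⁺ (inj₁ (∈-subsetOf⁺ isX? (x∈S , c , x↔c , c↔)))))
    ...   | no c↮  = x∈p∪q⁺ (inj₂ (∈-subsetOf⁺ isZ? (x∈S , c , x↔c , c↮)))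

    disjointXY : Disjoint X Y
    disjointXY (x , m) with x∈p∩q⁻ X Y m
    ... | x∈X , x∈Y with ∈-subsetOf⁻ isX? x∈X | ∈-subsetOf⁻ isY? x∈Y
    ...   | _ , c , x↔c , _ | _ , noPartner = noPartner (c , x↔c)

    disjointXZ : Disjoint X Z
    disjointXZ (x , m) with x∈p∩q⁻ X Z m
    ... | x∈X , x∈Z with ∈-subsetOf⁻ isX? x∈X | ∈-subsetOf⁻ isZ? x∈Z
    ...   | x∈S , c , x↔c , c↔ | _ , c′ , x↔c′ , c′↮ =
      c′↮ (subst HasPartner (partner-unique x∈S x↔c x↔c′) c↔)

    disjointYZ : Disjoint Y Z
    disjointYZ (x , m) with x∈p∩q⁻ Y Z m
    ... | x∈Y , x∈Z with ∈-subsetOf⁻ isY? x∈Y | ∈-subsetOf⁻ isZ? x∈Z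
    ...   | _ , noPartner | _ , c , x↔c , _ = noPartner (c , x↔c)

  pairPartition : PairPartition X pair
  pairPartition =
    (λ i → ∣pair∣≡2 (≢-sym (proj₁ (PairedVertex.x↔ (paired i))))) ,
    (λ i {x} m → inX i (∈-pair⁻ m)) ,
    (λ x m → let (i , eq) = pairIndex (∈-subsetOf⁻ isX? m) in
               i , subst (x ∈_) (sym eq) (∈-pair⁺ (inj₁ refl))) ,
    disjoint
    where
    paired : ∀ i → PairedVertex (representative i)
    paired i = pairedVertex (proj₁ (representative-isRep i))

    inX : ∀ i {x} → x ≡ representative i ⊎ x ≡ partnerOf (representative i) → x ∈ X
    inX i (inj₁ refl) = ∈-subsetOf⁺ isX? (proj₁ (representative-isRep i))
    inX i (inj₂ refl) = ∈-subsetOf⁺ isX? (PairedVertex.partner∈X (paired i))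

    -- A representative is smaller than its partner, so it is not the partner
    -- of another representative.
    notPartnerOfRep : ∀ i j → representative i ≢ partnerOf (representative j)
    notPartnerOfRep i j eq = <-asym (proj₂ (representative-isRep j))
      (subst (λ w → toℕ (partnerOf (representative j)) < toℕ w) (PairedVertex.involutive (paired j))
        (subst (λ w → toℕ w < toℕ (partnerOf w)) eq (proj₂ (representative-isRep i))))

    disjoint : ∀ i j → i ≢ j → Disjoint (pair i) (pair j)
    disjoint i j i≢j (z , m) with x∈p∩q⁻ (pair i) (pair j) m
    ... | z∈i , z∈j with ∈-pair⁻ z∈i | ∈-pair⁻ z∈j
    ...   | inj₁ z≡i | inj₁ z≡j = i≢j (lookup-injective representatives-unique i j (trans (sym z≡i) z≡j))
    ...   | inj₁ z≡i | inj₂ z≡j = notPartnerOfRep i j (trans (sym z≡i) z≡j)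
    ...   | inj₂ z≡i | inj₁ z≡j = notPartnerOfRep j i (trans (sym z≡j) z≡i)
    ...   | inj₂ z≡i | inj₂ z≡j = i≢j (lookup-injective representatives-unique i j (begin
      representative i                         ≡⟨ sym (PairedVertex.involutive (paired i)) ⟩
      partnerOf (partnerOf (representative i)) ≡⟨ cong partnerOf (trans (sym z≡i) z≡j) ⟩
      partnerOf (partnerOf (representative j)) ≡⟨ PairedVertex.involutive (paired j) ⟩
      representative j                         ∎))
      where open ≡-Reasoning

  indexedPartition : IndexedPartition Y Z A-of
  indexedPartition = inZ , covered , disjoint
    where
    inZ : ∀ y → y ∈ Y → A-of y ⊆ Z
    inZ y y∈Y m = let (z∈S , z↔y) = ∈-subsetOf⁻ (inA? y) m in
      ∈-subsetOf⁺ isZ? (z∈S , y , z↔y , proj₂ (∈-subsetOf⁻ isY? y∈Y))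

    covered : ∀ z → z ∈ Z → ∃ λ y → y ∈ Y × z ∈ A-of y
    covered z m = let (z∈S , c , z↔c , c↮) = ∈-subsetOf⁻ isZ? m in
      c , ∈-subsetOf⁺ isY? (partner∈S z∈S z↔c , c↮) , ∈-subsetOf⁺ (inA? c) (z∈S , z↔c)

    disjoint : ∀ v w → v ∈ Y → w ∈ Y → v ≢ w → Disjoint (A-of v) (A-of w)
    disjoint v w _ _ v≢w (z , m) with x∈p∩q⁻ (A-of v) (A-of w) m
    ... | z∈Av , z∈Aw with ∈-subsetOf⁻ (inA? v) z∈Av | ∈-subsetOf⁻ (inA? w) z∈Aw
    ...   | z∈S , z↔v | _ , z↔w = v≢w (partner-unique z∈S z↔v z↔w)

  record EdgeShape (e : Subset n) : Set where
    field
      y p q         : Fin n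
      q≢y           : q ≢ y
      y∈            : y ∈ e
      p∈            : p ∈ e
      q∈            : q ∈ e
      cover         : ∀ {x} → x ∈ e → OneOf3 x y p q
      y-partnerless : ¬ HasPartner y
      p↔            : Partner p (partnerOf p)
      q↔            : Partner q (partnerOf q)

  edgeShape : ∀ {e} → e ∈L E → EdgeShape e
  edgeShape {e} eE with partnerlessVertexOf eE
  ... | y , y∈e , noPartner with othersOf eE y∈e
  ...   | otherTwo p q p≢y q≢y _ p∈e q∈e cover = record
    { y = y ; p = p ; q = q ; q≢y = q≢y ; y∈ = y∈e ; p∈ = p∈e ; q∈ = q∈e
    ; cover = cover ; y-partnerless = noPartner ; p↔ = chosenPartner p≢y p∈e ; q↔ = chosenPartner q≢y q∈e }
    where
    chosenPartner : ∀ {v} → v ≢ y → v ∈ e → Partner v (partnerOf v)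
    chosenPartner {v} v≢y v∈e
      with Partnerless.neighbourHasPartner (E-inside eE y∈e) noPartner (≢-sym v≢y) eE y∈e v∈e
    ... | c , v↔c = subst (Partner v) (sym (partnerOf-spec (E-inside eE v∈e) v↔c)) v↔c

  -- Each edge has one of the two forms of the theorem: its partnerless vertex y
  -- is its only vertex in Y, and either its other two vertices are partners of
  -- each other (a pair of X) or both have partner y (they lie in A_y).
  module EdgeForm {e} (eE : e ∈L E) where

    open EdgeShape (edgeShape eE)

    y∈Y : y ∈ Y
    y∈Y = ∈-subsetOf⁺ isY? (E-inside eE y∈ , y-partnerless)

    e∩Y≡⁅y⁆ : e ∩ Y ≡ ⁅ y ⁆
    e∩Y≡⁅y⁆ = ⊆-antisym onlyY (λ m → subst (_∈ e ∩ Y) (sym (x∈⁅y⁆⇒x≡y y m)) (x∈p∩q⁺ (y∈ , y∈Y)))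
      where
      onlyY : ∀ {x} → x ∈ e ∩ Y → x ∈ ⁅ y ⁆
      onlyY m with x∈p∩q⁻ e Y m
      ... | x∈e , x∈Y with cover x∈e
      ...   | inj₁ refl        = x∈⁅x⁆ y
      ...   | inj₂ (inj₁ refl) = ⊥-elim (proj₂ (∈-subsetOf⁻ isY? x∈Y) (_ , p↔))
      ...   | inj₂ (inj₂ refl) = ⊥-elim (proj₂ (∈-subsetOf⁻ isY? x∈Y) (_ , q↔))

    pairForm : partnerOf p ≡ q → (∃ λ i → e ∩ X ≡ pair i) × ∣ e ∩ Y ∣ ≡ 1
    pairForm cp≡q = (proj₁ index , trans e∩X≡pq (sym pairEq)) , trans (cong ∣_∣ e∩Y≡⁅y⁆) (∣⁅x⁆∣≡1 y)
      where
      p↔q : Partner p q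
      p↔q = subst (Partner p) cp≡q p↔
      q↔p : Partner q p
      q↔p = subst (Partner q) (partner-mutual (E-inside eE p∈) p↔q q↔) q↔
      p∈X : IsX p
      p∈X = E-inside eE p∈ , q , p↔q , p , q↔p
      q∈X : IsX q
      q∈X = E-inside eE q∈ , p , q↔p , q , p↔q
      index = pairIndex p∈X
      pairEq : pair (proj₁ index) ≡ ⁅ p ⁆ ∪ ⁅ q ⁆
      pairEq = trans (proj₂ index) (cong (λ w → ⁅ p ⁆ ∪ ⁅ w ⁆) cp≡q)
      e∩X≡pq : e ∩ X ≡ ⁅ p ⁆ ∪ ⁅ q ⁆
      e∩X≡pq = ⊆-antisym onlyPQ (bothIn ∘ ∈-pair⁻)
        where
        onlyPQ : ∀ {x} → x ∈ e ∩ X → x ∈ ⁅ p ⁆ ∪ ⁅ q ⁆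
        onlyPQ m with x∈p∩q⁻ e X m
        ... | x∈e , x∈X with cover x∈e
        ...   | inj₁ refl        =
          ⊥-elim (y-partnerless (let (_ , c , x↔c , _) = ∈-subsetOf⁻ isX? x∈X in c , x↔c))
        ...   | inj₂ (inj₁ refl) = ∈-pair⁺ (inj₁ refl)
        ...   | inj₂ (inj₂ refl) = ∈-pair⁺ (inj₂ refl)
        bothIn : ∀ {x} → x ≡ p ⊎ x ≡ q → x ∈ e ∩ X
        bothIn (inj₁ refl) = x∈p∩q⁺ (p∈ , ∈-subsetOf⁺ isX? p∈X)
        bothIn (inj₂ refl) = x∈p∩q⁺ (q∈ , ∈-subsetOf⁺ isX? q∈X)

    -- p has partner y; then so has q, as its partner cannot be p.
    starForm : partnerOf p ≡ y → ∃ λ v → v ∈ Y × e ∩ Y ≡ ⁅ v ⁆ × (e - v) ⊆ A-of v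
    starForm cp≡y with cover (proj₂ q↔ eE q∈)
    ... | inj₂ (inj₂ cq≡q) = ⊥-elim (proj₁ q↔ cq≡q)
    ... | inj₂ (inj₁ cq≡p) =
      ⊥-elim (q≢y (sym (partner-mutual (E-inside eE q∈)
                         (subst (Partner q) cq≡p q↔) (subst (Partner p) cp≡y p↔))))
    ... | inj₁ cq≡y = y , y∈Y , e∩Y≡⁅y⁆ , inA
      where
      inA : ∀ {x} → x ∈ e - y → x ∈ A-of y
      inA {x} m with cover (p─q⊆p e ⁅ y ⁆ m)
      ... | inj₁ x≡y         = ⊥-elim (∈--⁻ {p = e} m x≡y)
      ... | inj₂ (inj₁ refl) = ∈-subsetOf⁺ (inA? y) (E-inside eE p∈ , subst (Partner p) cp≡y p↔)
      ... | inj₂ (inj₂ refl) = ∈-subsetOf⁺ (inA? y) (E-inside eE q∈ , subst (Partner q) cq≡y q↔)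

    -- The partner of p lies on e, so it is q or y.
    form : ((∃ λ i → e ∩ X ≡ pair i) × ∣ e ∩ Y ∣ ≡ 1)
           ⊎ (∃ λ v → v ∈ Y × e ∩ Y ≡ ⁅ v ⁆ × (e - v) ⊆ A-of v)
    form with cover (proj₂ p↔ eE p∈)
    ... | inj₁ cp≡y         = inj₂ (starForm cp≡y)
    ... | inj₂ (inj₁ cp≡p)  = ⊥-elim (proj₁ p↔ cp≡p)
    ... | inj₂ (inj₂ cp≡q)  = inj₁ (pairForm cp≡q)

  structure : Structured E S
  structure = X , Y , Z , pairCount , pair , A-of ,
              partition₃ , pairPartition , indexedPartition , (λ e eE → EdgeForm.form eE)

mainTheorem4 : ∀ {n} (H : Hypergraph3 n) → ¬ ContainsLoosePath H →
    (S : Subset n) → IsCoreVertexSet H 22 S → Structured (edgesOn H S) S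
mainTheorem4 H noLoosePath S (_ , minDegree) =
  Core.structure S (edgesOn H S)
    (Unique.filter⁺ (_⊆? S) (unique H))
    (λ e∈ → All.lookup (uniform H) (edge e∈))
    (λ e∈ x∈e → proj₂ (∈-filter⁻ (_⊆? S) {xs = edges H} e∈) x∈e)
    (λ v∈S → ≤-trans (n≤1+n 21) (minDegree _ v∈S))
    (λ a b c d e f g distinct abc cde efg →
       noLoosePath (a , b , c , d , e , f , g , distinct , edge abc , edge cde , edge efg))
  where
  edge : ∀ {t} → t ∈L edgesOn H S → t ∈L edges H
  edge = proj₁ ∘ ∈-filter⁻ (_⊆? S) {xs = edges H}
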